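{- Let $m\in[p^k]$ and $f:R\to\mathbb{Z}/p\mathbb{Z}$. The following are equivalent: (i) $f\in\Omega_{m-1}$; (ii) $D^mf=0$; (iii) for every choice of $c_1,\dots,c_m\in R$, $\Delta_{c_m}\cdots\Delta_{c_1}f=0$.
   Context: Let $p$ be prime, $k\in\mathbb{N}$, $R=\mathbb{Z}/p^k\mathbb{Z}$ with representatives $\{0,\dots,p^k-1\}$, $[m]=\{0,\dots,m-1\}$. For $j\in[p^k]$, $\phi_j:R\to\mathbb{Z}/p\mathbb{Z}$, $\phi_j(x)=\binom{x}{j}\bmod p$ (using the representative of $x$; $\binom{a}{b}=0$ for $a<b$). For integer $N$, $\Omega_N=\operatorname{span}_{\mathbb{Z}/p\mathbb{Z}}\{\phi_j:0\leq j\leq N\}$, with $\Omega_N=\{0\}$ for $N<0$. For $c\in R$, $\Delta_cf(x)=f(x+c)-f(x)$, and $Df=\Delta_1f$; $D^m$ is the $m$-fold iterate ($D^0f=f$). -}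

module Defs where

open import Data.Nat using (ℕ; zero; suc; _+_; _*_; _∸_; _^_; NonZero)
open import Data.Nat.Properties using (m^n≢0)
open import Data.Nat.DivMod using (_mod_)
open import Data.Nat.Combinatorics using (_C_)
open import Data.Fin using (Fin; toℕ; fromℕ; inject₁)
open import Data.Product using (Σ)
open import Relation.Binary.PropositionalEquality using (_≡_)

-- Conventions: p : ℕ with NonZero p (primality is assumed in the statement).
-- R = ℤ/p^kℤ is modelled as Fin (p ^ k) (representatives 0,…,p^k-1),
-- ℤ/pℤ is modelled as Fin p.  Ring operations are done on representatives
-- and reduced with _mod_.

R : (p k : ℕ) → Set
R p k = Fin (p ^ k)

Zp : (p : ℕ) → Set
Zp p = Fin p

addR : (p k : ℕ) → .{{_ : NonZero p}} → R p k → R p k → R p k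
addR p k x y = (toℕ x + toℕ y) mod (p ^ k)
  where instance _ = m^n≢0 p k

addZp : (p : ℕ) → .{{_ : NonZero p}} → Zp p → Zp p → Zp p
addZp p a b = (toℕ a + toℕ b) mod p

mulZp : (p : ℕ) → .{{_ : NonZero p}} → Zp p → Zp p → Zp p
mulZp p a b = (toℕ a * toℕ b) mod p

-- a - b  =  (a + (p - b)) mod p   (b < p, so p ∸ b is the true difference)
subZp : (p : ℕ) → .{{_ : NonZero p}} → Zp p → Zp p → Zp p
subZp p a b = (toℕ a + (p ∸ toℕ b)) mod p

zeroZp : (p : ℕ) → .{{_ : NonZero p}} → Zp p
zeroZp p = 0 mod p

-- φ_j(x) = binom(x, j) mod p, using the representative of x
φ : (p k : ℕ) → .{{_ : NonZero p}} → ℕ → R p k → Zp p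
φ p k j x = (toℕ x C j) mod p

Δ : (p k : ℕ) → .{{_ : NonZero p}} → R p k → (R p k → Zp p) → (R p k → Zp p)
Δ p k c f x = subZp p (f (addR p k x c)) (f x)

oneR : (p k : ℕ) → .{{_ : NonZero p}} → R p k
oneR p k = 1 mod (p ^ k)
  where instance _ = m^n≢0 p k

D : (p k : ℕ) → .{{_ : NonZero p}} → (R p k → Zp p) → (R p k → Zp p)
D p k = Δ p k (oneR p k)

Dpow : (p k : ℕ) → .{{_ : NonZero p}} → ℕ → (R p k → Zp p) → (R p k → Zp p)
Dpow p k zero f = f
Dpow p k (suc m) f = D p k (Dpow p k m f)

-- Δ_{c_m} ⋯ Δ_{c_1} f  for c : Fin m → R (c i = c_{i+1}); Δ_{c_1} applied first
iterΔ : (p k : ℕ) → .{{_ : NonZero p}} → (m : ℕ) → (Fin m → R p k) →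
        (R p k → Zp p) → (R p k → Zp p)
iterΔ p k zero c f = f
iterΔ p k (suc m) c f = Δ p k (c (fromℕ m)) (iterΔ p k m (λ i → c (inject₁ i)) f)

IsZeroFun : (p k : ℕ) → .{{_ : NonZero p}} → (R p k → Zp p) → Set
IsZeroFun p k f = ∀ x → f x ≡ zeroZp p

linComb : (p k : ℕ) → .{{_ : NonZero p}} → (m : ℕ) → (Fin m → Zp p) → R p k → Zp p
linComb p k zero a x = zeroZp p
linComb p k (suc m) a x =
  addZp p (linComb p k m (λ i → a (inject₁ i)) x)
          (mulZp p (a (fromℕ m)) (φ p k m x))

-- Ω_N membership for N = m - 1, i.e. f ∈ span{φ_j : 0 ≤ j < m}
-- (for m = 0 this is Ω_{-1} = {0}: the empty sum)
InΩbelow : (p k : ℕ) → .{{_ : NonZero p}} → (m : ℕ) → (R p k → Zp p) → Set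
InΩbelow p k m f = Σ (Fin m → Zp p) (λ a → ∀ x → f x ≡ linComb p k m a x)

module Submission where

-- Pascal's rule gives D φ_{j+1} = φ_j; at the wrap-around x = p^k - 1 it still holds because
-- p divides C(p^k, j+1) for 0 < j+1 < p^k, by (j+1) C(p^k, j+1) = p^k C(p^k - 1, j).  Hence D^m
-- kills Ω_{m-1}.  Conversely, if D^m f = 0 then inductively D f ∈ Ω_{m-2}, and subtracting from f
-- the matching combination of φ_1, …, φ_{m-1} leaves a function killed by D, i.e. a constant.
-- Finally D commutes with every Δ_c, and a function killed by D is constant and so killed by
-- every Δ_c; this gives (ii) ⇒ (iii), while (iii) ⇒ (ii) is the choice c_i = 1.

open import Defs
open import Level using (0ℓ)
open import Algebra.Bundles using (CommutativeRing)
open import Algebra.Structures using (IsCommutativeRing)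
open import Algebra.Consequences.Propositional using (comm∧idˡ⇒id; comm∧invˡ⇒inv; comm∧distrˡ⇒distrʳ)
open import Data.Nat using (ℕ; zero; suc; _+_; _*_; _∸_; _^_; _<_; _≤_; NonZero; >-nonZero⁻¹)
open import Data.Nat.Properties using (m≤n⇒m<n∨m≡n; ≤-trans; n≤1+n; *-zeroʳ; *-identityʳ; m^n≢0; *-commutativeSemigroup; +-assoc; +-comm; *-assoc; *-comm; *-identityˡ; *-distribˡ-+; m∸n+n≡m; <⇒≤)
open import Data.Nat.DivMod using (_mod_; _%_; %-distribˡ-+; %-distribˡ-*; m<n⇒m%n≡m; n%n≡0)
open import Data.Nat.Combinatorics using (_C_; nC1≡n; nCk+nC[k+1]≡[n+1]C[k+1])
open import Data.Nat.Divisibility using (n∣m⇒m%n≡0; _∣_; _∤_; divides; _∣?_; ∣-trans; n∣m*n; 1∣_; *-monoˡ-∣; *-cancelʳ-∣; >⇒∤)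
open import Data.Nat.Primality using (Prime; prime⇒nonZero; euclidsLemma)
open import Data.Fin using (Fin; toℕ; zero; suc; fromℕ; inject₁)
open import Data.Fin.Properties using (toℕ-injective; toℕ-fromℕ<; toℕ<n)
open import Data.Product using (_×_; _,_)
open import Function.Bundles using (_⇔_; mk⇔)
open import Data.Sum using ([_,_]; inj₁; inj₂)
open import Data.Vec.Functional using (_∷_)
open import Function using (id; flip; const)
open import Relation.Nullary using (yes; no; contradiction)
open import Relation.Binary.PropositionalEquality
  using (_≡_; refl; sym; trans; cong; cong₂; subst; _≗_; isEquivalence; module ≡-Reasoning)

module ZMod (n : ℕ) .{{_ : NonZero n}} where

  infixl 6 _⊕_ _⊖_
  infixl 7 _⊛_
  infix 8 ⊝_

  _⊕_ _⊛_ _⊖_ : Fin n → Fin n → Fin n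
  _⊕_ = addZp n
  _⊛_ = mulZp n
  _⊖_ = subZp n

  ⊝_ : Fin n → Fin n
  ⊝ a = (n ∸ toℕ a) mod n

  𝟘 𝟙 : Fin n
  𝟘 = zeroZp n
  𝟙 = 1 mod n

  0%n≡0 : 0 % n ≡ 0
  0%n≡0 = m<n⇒m%n≡m (>-nonZero⁻¹ n)

  toℕ-mod : ∀ m → toℕ (m mod n) ≡ m % n
  toℕ-mod m = toℕ-fromℕ< _

  mod-cong : ∀ {m m′} → m % n ≡ m′ % n → m mod n ≡ m′ mod n
  mod-cong {m} {m′} eq = toℕ-injective (trans (toℕ-mod m) (trans eq (sym (toℕ-mod m′))))

  toℕ-mod-inverse : ∀ (a : Fin n) → toℕ a mod n ≡ a
  toℕ-mod-inverse a = toℕ-injective (trans (toℕ-mod (toℕ a)) (m<n⇒m%n≡m (toℕ<n a)))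

  mod-distrib-+ : ∀ m m′ → (m + m′) mod n ≡ m mod n ⊕ m′ mod n
  mod-distrib-+ m m′ = mod-cong (trans (%-distribˡ-+ m m′ n)
    (sym (cong₂ (λ u v → (u + v) % n) (toℕ-mod m) (toℕ-mod m′))))

  mod-distrib-* : ∀ m m′ → (m * m′) mod n ≡ (m mod n) ⊛ (m′ mod n)
  mod-distrib-* m m′ = mod-cong (trans (%-distribˡ-* m m′ n)
    (sym (cong₂ (λ u v → (u * v) % n) (toℕ-mod m) (toℕ-mod m′))))

  open ≡-Reasoning
  open import Algebra.Definitions {A = Fin n} _≡_

  ⊕-assoc : Associative _⊕_
  ⊕-assoc a b c = begin
    (a ⊕ b) ⊕ c                      ≡⟨ cong ((a ⊕ b) ⊕_) (toℕ-mod-inverse c) ⟨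
    (a ⊕ b) ⊕ (toℕ c mod n)          ≡⟨ mod-distrib-+ (toℕ a + toℕ b) (toℕ c) ⟨
    (toℕ a + toℕ b + toℕ c) mod n    ≡⟨ cong (_mod n) (+-assoc (toℕ a) (toℕ b) (toℕ c)) ⟩
    (toℕ a + (toℕ b + toℕ c)) mod n  ≡⟨ mod-distrib-+ (toℕ a) (toℕ b + toℕ c) ⟩
    (toℕ a mod n) ⊕ (b ⊕ c)          ≡⟨ cong (_⊕ (b ⊕ c)) (toℕ-mod-inverse a) ⟩
    a ⊕ (b ⊕ c)                      ∎

  ⊛-assoc : Associative _⊛_
  ⊛-assoc a b c = begin
    (a ⊛ b) ⊛ c                      ≡⟨ cong ((a ⊛ b) ⊛_) (toℕ-mod-inverse c) ⟨
    (a ⊛ b) ⊛ (toℕ c mod n)          ≡⟨ mod-distrib-* (toℕ a * toℕ b) (toℕ c) ⟨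
    (toℕ a * toℕ b * toℕ c) mod n    ≡⟨ cong (_mod n) (*-assoc (toℕ a) (toℕ b) (toℕ c)) ⟩
    (toℕ a * (toℕ b * toℕ c)) mod n  ≡⟨ mod-distrib-* (toℕ a) (toℕ b * toℕ c) ⟩
    (toℕ a mod n) ⊛ (b ⊛ c)          ≡⟨ cong (_⊛ (b ⊛ c)) (toℕ-mod-inverse a) ⟩
    a ⊛ (b ⊛ c)                      ∎

  ⊕-comm : Commutative _⊕_
  ⊕-comm a b = cong (_mod n) (+-comm (toℕ a) (toℕ b))

  ⊛-comm : Commutative _⊛_
  ⊛-comm a b = cong (_mod n) (*-comm (toℕ a) (toℕ b))

  ⊕-identityˡ : LeftIdentity 𝟘 _⊕_
  ⊕-identityˡ a = begin
    𝟘 ⊕ a              ≡⟨ cong (𝟘 ⊕_) (toℕ-mod-inverse a) ⟨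
    𝟘 ⊕ (toℕ a mod n)  ≡⟨ mod-distrib-+ 0 (toℕ a) ⟨
    toℕ a mod n        ≡⟨ toℕ-mod-inverse a ⟩
    a                  ∎

  ⊛-identityˡ : LeftIdentity 𝟙 _⊛_
  ⊛-identityˡ a = begin
    𝟙 ⊛ a              ≡⟨ cong (𝟙 ⊛_) (toℕ-mod-inverse a) ⟨
    𝟙 ⊛ (toℕ a mod n)  ≡⟨ mod-distrib-* 1 (toℕ a) ⟨
    (1 * toℕ a) mod n  ≡⟨ cong (_mod n) (*-identityˡ (toℕ a)) ⟩
    toℕ a mod n        ≡⟨ toℕ-mod-inverse a ⟩
    a                  ∎

  ⊝-inverseˡ : LeftInverse 𝟘 ⊝_ _⊕_
  ⊝-inverseˡ a = begin
    ⊝ a ⊕ a                    ≡⟨ cong (⊝ a ⊕_) (toℕ-mod-inverse a) ⟨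
    ⊝ a ⊕ (toℕ a mod n)        ≡⟨ mod-distrib-+ (n ∸ toℕ a) (toℕ a) ⟨
    (n ∸ toℕ a + toℕ a) mod n  ≡⟨ cong (_mod n) (m∸n+n≡m (<⇒≤ (toℕ<n a))) ⟩
    n mod n                    ≡⟨ mod-cong (trans (n%n≡0 n) (sym 0%n≡0)) ⟩
    𝟘                          ∎

  ⊛-distribˡ-⊕ : _⊛_ DistributesOverˡ _⊕_
  ⊛-distribˡ-⊕ a b c = begin
    a ⊛ (b ⊕ c)                            ≡⟨ cong (_⊛ (b ⊕ c)) (toℕ-mod-inverse a) ⟨
    (toℕ a mod n) ⊛ (b ⊕ c)                ≡⟨ mod-distrib-* (toℕ a) (toℕ b + toℕ c) ⟨
    (toℕ a * (toℕ b + toℕ c)) mod n        ≡⟨ cong (_mod n) (*-distribˡ-+ (toℕ a) (toℕ b) (toℕ c)) ⟩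
    (toℕ a * toℕ b + toℕ a * toℕ c) mod n  ≡⟨ mod-distrib-+ (toℕ a * toℕ b) (toℕ a * toℕ c) ⟩
    a ⊛ b ⊕ a ⊛ c                          ∎

  isCommutativeRing : IsCommutativeRing _≡_ _⊕_ _⊛_ ⊝_ 𝟘 𝟙
  isCommutativeRing = record
    { isRing = record
      { +-isAbelianGroup = record
        { isGroup = record
          { isMonoid = record
            { isSemigroup = record
              { isMagma = record { isEquivalence = isEquivalence ; ∙-cong = cong₂ _⊕_ }
              ; assoc = ⊕-assoc }
            ; identity = comm∧idˡ⇒id ⊕-comm ⊕-identityˡ }
          ; inverse = comm∧invˡ⇒inv ⊕-comm ⊝-inverseˡ
          ; ⁻¹-cong = cong ⊝_ }
        ; comm = ⊕-comm }
      ; *-cong = cong₂ _⊛_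
      ; *-assoc = ⊛-assoc
      ; *-identity = comm∧idˡ⇒id ⊛-comm ⊛-identityˡ
      ; distrib = ⊛-distribˡ-⊕ , comm∧distrˡ⇒distrʳ ⊛-comm ⊛-distribˡ-⊕ }
    ; *-comm = ⊛-comm }

  commutativeRing : CommutativeRing 0ℓ 0ℓ
  commutativeRing = record { isCommutativeRing = isCommutativeRing }

  open CommutativeRing commutativeRing using (+-abelianGroup; ring; +-commutativeSemigroup)
  open import Algebra.Properties.AbelianGroup +-abelianGroup
    using (x∙y⁻¹≈ε⇒x≈y; //-rightDividesʳ; ⁻¹-anti-homo‿-; ⁻¹-∙-comm; ⁻¹-involutive)
  open import Algebra.Properties.CommutativeSemigroup +-commutativeSemigroup using (interchange)
  open import Algebra.Properties.Ring ring using (x[y-z]≈xy-xz)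

  open CommutativeRing commutativeRing public
    using () renaming (+-identityʳ to ⊕-identityʳ; *-identityʳ to ⊛-identityʳ; zeroʳ to ⊛-zeroʳ)

  toℕ-𝟘 : toℕ 𝟘 ≡ 0
  toℕ-𝟘 = trans (toℕ-mod 0) 0%n≡0

  ∣⇒mod≡𝟘 : ∀ {m} → n ∣ m → m mod n ≡ 𝟘
  ∣⇒mod≡𝟘 {m} n∣m = mod-cong (trans (n∣m⇒m%n≡0 m n n∣m) (sym 0%n≡0))

  mod-suc : ∀ m → suc m mod n ≡ m mod n ⊕ 𝟙
  mod-suc m = trans (cong (_mod n) (+-comm 1 m)) (mod-distrib-+ m 1)

  ⊕𝟙≡suc-mod : ∀ a → a ⊕ 𝟙 ≡ suc (toℕ a) mod n
  ⊕𝟙≡suc-mod a = trans (cong (_⊕ 𝟙) (sym (toℕ-mod-inverse a))) (sym (mod-suc (toℕ a)))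

  ⊖-def : ∀ a b → a ⊖ b ≡ a ⊕ ⊝ b
  ⊖-def a b = begin
    (toℕ a + (n ∸ toℕ b)) mod n  ≡⟨ mod-distrib-+ (toℕ a) (n ∸ toℕ b) ⟩
    (toℕ a mod n) ⊕ ⊝ b          ≡⟨ cong (_⊕ ⊝ b) (toℕ-mod-inverse a) ⟩
    a ⊕ ⊝ b                      ∎

  ⊖-self : ∀ a → a ⊖ a ≡ 𝟘
  ⊖-self a = trans (⊖-def a a) (CommutativeRing.-‿inverseʳ commutativeRing a)

  ⊖≡𝟘⇒≡ : ∀ {a b} → a ⊖ b ≡ 𝟘 → a ≡ b
  ⊖≡𝟘⇒≡ {a} {b} eq = x∙y⁻¹≈ε⇒x≈y a b (trans (sym (⊖-def a b)) eq)

  ⊕-⊖-cancelʳ : ∀ a b → (a ⊕ b) ⊖ b ≡ a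
  ⊕-⊖-cancelʳ a b = trans (⊖-def (a ⊕ b) b) (//-rightDividesʳ b a)

  ⊕-⊖-interchange : ∀ a b c d → (a ⊕ b) ⊖ (c ⊕ d) ≡ (a ⊖ c) ⊕ (b ⊖ d)
  ⊕-⊖-interchange a b c d = begin
    (a ⊕ b) ⊖ (c ⊕ d)      ≡⟨ ⊖-def (a ⊕ b) (c ⊕ d) ⟩
    (a ⊕ b) ⊕ ⊝ (c ⊕ d)    ≡⟨ cong ((a ⊕ b) ⊕_) (⁻¹-∙-comm c d) ⟨
    (a ⊕ b) ⊕ (⊝ c ⊕ ⊝ d)  ≡⟨ interchange a b (⊝ c) (⊝ d) ⟩
    (a ⊕ ⊝ c) ⊕ (b ⊕ ⊝ d)  ≡⟨ cong₂ _⊕_ (⊖-def a c) (⊖-def b d) ⟨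
    (a ⊖ c) ⊕ (b ⊖ d)      ∎

  ⊝-distrib-⊖ : ∀ a b → ⊝ (a ⊖ b) ≡ ⊝ a ⊖ ⊝ b
  ⊝-distrib-⊖ a b = begin
    ⊝ (a ⊖ b)    ≡⟨ cong ⊝_ (⊖-def a b) ⟩
    ⊝ (a ⊕ ⊝ b)  ≡⟨ ⁻¹-anti-homo‿- a b ⟩
    b ⊕ ⊝ a      ≡⟨ ⊕-comm b (⊝ a) ⟩
    ⊝ a ⊕ b      ≡⟨ cong (⊝ a ⊕_) (⁻¹-involutive b) ⟨
    ⊝ a ⊕ ⊝ ⊝ b  ≡⟨ ⊖-def (⊝ a) (⊝ b) ⟨
    ⊝ a ⊖ ⊝ b    ∎

  ⊖-interchange : ∀ a b c d → (a ⊖ b) ⊖ (c ⊖ d) ≡ (a ⊖ c) ⊖ (b ⊖ d)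
  ⊖-interchange a b c d = begin
    (a ⊖ b) ⊖ (c ⊖ d)      ≡⟨ cong₂ _⊖_ (⊖-def a b) (⊖-def c d) ⟩
    (a ⊕ ⊝ b) ⊖ (c ⊕ ⊝ d)  ≡⟨ ⊕-⊖-interchange a (⊝ b) c (⊝ d) ⟩
    (a ⊖ c) ⊕ (⊝ b ⊖ ⊝ d)  ≡⟨ cong ((a ⊖ c) ⊕_) (⊝-distrib-⊖ b d) ⟨
    (a ⊖ c) ⊕ ⊝ (b ⊖ d)    ≡⟨ ⊖-def (a ⊖ c) (b ⊖ d) ⟨
    (a ⊖ c) ⊖ (b ⊖ d)      ∎

  ⊛-distribˡ-⊖ : ∀ a b c → a ⊛ (b ⊖ c) ≡ a ⊛ b ⊖ a ⊛ c
  ⊛-distribˡ-⊖ a b c = begin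
    a ⊛ (b ⊖ c)        ≡⟨ cong (a ⊛_) (⊖-def b c) ⟩
    a ⊛ (b ⊕ ⊝ c)      ≡⟨ x[y-z]≈xy-xz a b c ⟩
    a ⊛ b ⊕ ⊝ (a ⊛ c)  ≡⟨ ⊖-def (a ⊛ b) (a ⊛ c) ⟨
    a ⊛ b ⊖ a ⊛ c      ∎

[1+k]*[1+n]C[1+k]≡[1+n]*nCk : ∀ n k → suc k * (suc n C suc k) ≡ suc n * (n C k)
[1+k]*[1+n]C[1+k]≡[1+n]*nCk zero    zero    = refl
[1+k]*[1+n]C[1+k]≡[1+n]*nCk zero    (suc k) = *-zeroʳ (suc (suc k))
[1+k]*[1+n]C[1+k]≡[1+n]*nCk (suc n) zero    = trans (*-identityˡ _) (trans (nC1≡n (suc (suc n))) (sym (*-identityʳ _)))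
[1+k]*[1+n]C[1+k]≡[1+n]*nCk (suc n) (suc k) = begin
  suc (suc k) * (suc (suc n) C suc (suc k))    ≡⟨ cong (suc (suc k) *_) (nCk+nC[k+1]≡[n+1]C[k+1] (suc n) (suc k)) ⟨
  suc (suc k) * (A + B)                        ≡⟨ *-distribˡ-+ (suc (suc k)) A B ⟩
  (A + suc k * A) + suc (suc k) * B            ≡⟨ cong₂ (λ u v → (A + u) + v) ([1+k]*[1+n]C[1+k]≡[1+n]*nCk n k) ([1+k]*[1+n]C[1+k]≡[1+n]*nCk n (suc k)) ⟩
  (A + suc n * (n C k)) + suc n * (n C suc k)  ≡⟨ +-assoc A _ _ ⟩
  A + (suc n * (n C k) + suc n * (n C suc k))  ≡⟨ cong (A +_) (*-distribˡ-+ (suc n) (n C k) (n C suc k)) ⟨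
  A + suc n * (n C k + n C suc k)              ≡⟨ cong (λ c → A + suc n * c) (nCk+nC[k+1]≡[n+1]C[k+1] n k) ⟩
  suc (suc n) * A                              ∎
  where
  open ≡-Reasoning
  A = suc n C suc k
  B = suc n C suc (suc k)

n∣[1+i]*nC[1+i] : ∀ n i → n ∣ suc i * (n C suc i)
n∣[1+i]*nC[1+i] zero    i = divides 0 (*-zeroʳ (suc i))
n∣[1+i]*nC[1+i] (suc n) i = divides (n C i)
  (trans ([1+k]*[1+n]C[1+k]≡[1+n]*nCk n i) (*-comm (suc n) (n C i)))

module _ {p} (p-prime : Prime p) where

  private instance _ = prime⇒nonZero p-prime

  p^t∣m*c∧p∤c⇒p^t∣m : ∀ t {m c} → p ∤ c → p ^ t ∣ m * c → p ^ t ∣ m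
  p^t∣m*c∧p∤c⇒p^t∣m zero    {m} _   _     = 1∣ m
  p^t∣m*c∧p∤c⇒p^t∣m (suc t) {m} {c} p∤c p^[1+t]∣mc
    with p^t∣m*c∧p∤c⇒p^t∣m t {m} {c} p∤c (∣-trans (n∣m*n p) p^[1+t]∣mc)
  ... | divides q refl = *-monoˡ-∣ (p ^ t) p∣q
    where
    instance _ = m^n≢0 p t
    p∣q*c : p ∣ q * c
    p∣q*c = *-cancelʳ-∣ (p ^ t) (subst (p * p ^ t ∣_) (xy∙z≈xz∙y q (p ^ t) c) p^[1+t]∣mc)
      where open import Algebra.Properties.CommutativeSemigroup *-commutativeSemigroup using (xy∙z≈xz∙y)
    p∣q : p ∣ q
    p∣q = [ id , flip contradiction p∤c ] (euclidsLemma q c p-prime p∣q*c)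

  p∣p^kC[1+i] : ∀ k {i} → suc i < p ^ k → p ∣ p ^ k C suc i
  p∣p^kC[1+i] k {i} 1+i<p^k with p ∣? (p ^ k C suc i)
  ... | yes p∣ = p∣
  ... | no p∤ = contradiction (p^t∣m*c∧p∤c⇒p^t∣m k p∤ (n∣[1+i]*nC[1+i] (p ^ k) i)) (>⇒∤ 1+i<p^k)
    where instance _ = m^n≢0 p k

module Differences (p k : ℕ) .{{_ : NonZero p}} where

  private instance _ = m^n≢0 p k

  open ZMod p
  open ZMod (p ^ k) using () renaming
    (_⊕_ to _⊕ᴿ_; 𝟘 to 𝟘ᴿ; 𝟙 to 𝟙ᴿ; toℕ-𝟘 to toℕ-𝟘ᴿ; mod-suc to mod-sucᴿ; ⊕𝟙≡suc-mod to ⊕𝟙ᴿ≡suc-mod;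
     toℕ-mod to toℕ-modᴿ; toℕ-mod-inverse to toℕ-mod-inverseᴿ; commutativeRing to ringᴿ)
  open import Algebra.Properties.CommutativeSemigroup (CommutativeRing.+-commutativeSemigroup ringᴿ)
    using () renaming (xy∙z≈xz∙y to ⊕ᴿ-right-comm)

  open ≡-Reasoning

  Fun : Set
  Fun = R p k → Zp p

  D-cong : ∀ {f g : Fun} → f ≗ g → D p k f ≗ D p k g
  D-cong f≗g x = cong₂ _⊖_ (f≗g _) (f≗g x)

  Δ-cong : ∀ c {f g : Fun} → f ≗ g → Δ p k c f ≗ Δ p k c g
  Δ-cong c f≗g x = cong₂ _⊖_ (f≗g _) (f≗g x)

  Dpow-cong : ∀ m {f g : Fun} → f ≗ g → Dpow p k m f ≗ Dpow p k m g
  Dpow-cong zero    f≗g = f≗g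
  Dpow-cong (suc m) f≗g = D-cong (Dpow-cong m f≗g)

  Dpow-suc : ∀ m (f : Fun) → Dpow p k (suc m) f ≗ Dpow p k m (D p k f)
  Dpow-suc zero    f x = refl
  Dpow-suc (suc m) f x = D-cong (Dpow-suc m f) x

  Δ-D-comm : ∀ c (h : Fun) → Δ p k c (D p k h) ≗ D p k (Δ p k c h)
  Δ-D-comm c h x = trans
    (⊖-interchange (h (x ⊕ᴿ c ⊕ᴿ 𝟙ᴿ)) (h (x ⊕ᴿ c)) (h (x ⊕ᴿ 𝟙ᴿ)) (h x))
    (cong (λ y → (h y ⊖ h (x ⊕ᴿ 𝟙ᴿ)) ⊖ (h (x ⊕ᴿ c) ⊖ h x)) (⊕ᴿ-right-comm x c 𝟙ᴿ))

  iterΔ-D-comm : ∀ m c (f : Fun) → iterΔ p k m c (D p k f) ≗ D p k (iterΔ p k m c f)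
  iterΔ-D-comm zero    c f x = refl
  iterΔ-D-comm (suc m) c f x = trans
    (Δ-cong (c (fromℕ m)) (iterΔ-D-comm m (λ i → c (inject₁ i)) f) x)
    (Δ-D-comm (c (fromℕ m)) (iterΔ p k m (λ i → c (inject₁ i)) f) x)

  D≗𝟘⇒constant : ∀ (h : Fun) → D p k h ≗ const 𝟘 → ∀ x → h x ≡ h 𝟘ᴿ
  D≗𝟘⇒constant h Dh≗𝟘 x = trans (cong h (sym (toℕ-mod-inverseᴿ x))) (h[n]≡h𝟘 (toℕ x))
    where
    h[n]≡h𝟘 : ∀ n → h (n mod (p ^ k)) ≡ h 𝟘ᴿ
    h[n]≡h𝟘 zero    = refl
    h[n]≡h𝟘 (suc n) = trans (cong h (mod-sucᴿ n)) (trans (⊖≡𝟘⇒≡ (Dh≗𝟘 _)) (h[n]≡h𝟘 n))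

  D≗𝟘⇒Δ≗𝟘 : ∀ c (h : Fun) → D p k h ≗ const 𝟘 → Δ p k c h ≗ const 𝟘
  D≗𝟘⇒Δ≗𝟘 c h Dh≗𝟘 x = begin
    h (x ⊕ᴿ c) ⊖ h x  ≡⟨ cong₂ _⊖_ (D≗𝟘⇒constant h Dh≗𝟘 _) (D≗𝟘⇒constant h Dh≗𝟘 x) ⟩
    h 𝟘ᴿ ⊖ h 𝟘ᴿ       ≡⟨ ⊖-self (h 𝟘ᴿ) ⟩
    𝟘                 ∎

  Dpow≗𝟘⇒iterΔ≗𝟘 : ∀ m (f : Fun) → Dpow p k m f ≗ const 𝟘 → ∀ c → iterΔ p k m c f ≗ const 𝟘
  Dpow≗𝟘⇒iterΔ≗𝟘 zero    f Dᵐf≗𝟘 c = Dᵐf≗𝟘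
  Dpow≗𝟘⇒iterΔ≗𝟘 (suc m) f Dᵐf≗𝟘 c = D≗𝟘⇒Δ≗𝟘 (c (fromℕ m)) g Dg≗𝟘
    where
    c′ = λ i → c (inject₁ i)
    g = iterΔ p k m c′ f
    Dg≗𝟘 : D p k g ≗ const 𝟘
    Dg≗𝟘 x = trans (sym (iterΔ-D-comm m c′ f x))
      (Dpow≗𝟘⇒iterΔ≗𝟘 m (D p k f) (λ y → trans (sym (Dpow-suc m f y)) (Dᵐf≗𝟘 y)) c′ x)

  iterΔ-𝟙≗Dpow : ∀ m (f : Fun) → iterΔ p k m (λ _ → 𝟙ᴿ) f ≗ Dpow p k m f
  iterΔ-𝟙≗Dpow zero    f = λ _ → refl
  iterΔ-𝟙≗Dpow (suc m) f = D-cong (iterΔ-𝟙≗Dpow m f)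

  iterΔ≗𝟘⇒Dpow≗𝟘 : ∀ m (f : Fun) → (∀ c → iterΔ p k m c f ≗ const 𝟘) → Dpow p k m f ≗ const 𝟘
  iterΔ≗𝟘⇒Dpow≗𝟘 m f iterΔ≗𝟘 x = trans (sym (iterΔ-𝟙≗Dpow m f x)) (iterΔ≗𝟘 (λ _ → 𝟙ᴿ) x)

  D-linear : ∀ (F G : Fun) a → D p k (λ y → F y ⊕ a ⊛ G y) ≗ λ x → D p k F x ⊕ a ⊛ D p k G x
  D-linear F G a x = begin
    (F (x ⊕ᴿ 𝟙ᴿ) ⊕ a ⊛ G (x ⊕ᴿ 𝟙ᴿ)) ⊖ (F x ⊕ a ⊛ G x)  ≡⟨ ⊕-⊖-interchange (F (x ⊕ᴿ 𝟙ᴿ)) _ (F x) _ ⟩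
    D p k F x ⊕ (a ⊛ G (x ⊕ᴿ 𝟙ᴿ) ⊖ a ⊛ G x)            ≡⟨ cong (D p k F x ⊕_) (⊛-distribˡ-⊖ a _ _) ⟨
    D p k F x ⊕ a ⊛ D p k G x                          ∎

  D-distrib-⊖ : ∀ (F G : Fun) → D p k (λ y → F y ⊖ G y) ≗ λ x → D p k F x ⊖ D p k G x
  D-distrib-⊖ F G x = ⊖-interchange (F (x ⊕ᴿ 𝟙ᴿ)) (G (x ⊕ᴿ 𝟙ᴿ)) (F x) (G x)

  -- φ 0 computes to the constant 1 mod p, since n C 0 reduces to 1.
  D-φ₀≗𝟘 : D p k (φ p k 0) ≗ const 𝟘
  D-φ₀≗𝟘 x = ⊖-self 𝟙

  φ-at-𝟘ᴿ : ∀ j → φ p k (suc j) 𝟘ᴿ ≡ 𝟘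
  φ-at-𝟘ᴿ j = cong (λ t → (t C suc j) mod p) toℕ-𝟘ᴿ

  linComb-at-𝟘ᴿ : ∀ m b → linComb p k (suc m) b 𝟘ᴿ ≡ b zero
  linComb-at-𝟘ᴿ zero    b = trans (⊕-identityˡ _) (⊛-identityʳ (b zero))
  linComb-at-𝟘ᴿ (suc m) b = begin
    linComb p k (suc m) (λ i → b (inject₁ i)) 𝟘ᴿ ⊕ b (fromℕ (suc m)) ⊛ φ p k (suc m) 𝟘ᴿ
      ≡⟨ cong₂ (λ u v → u ⊕ b (fromℕ (suc m)) ⊛ v) (linComb-at-𝟘ᴿ m (λ i → b (inject₁ i))) (φ-at-𝟘ᴿ m) ⟩
    b zero ⊕ b (fromℕ (suc m)) ⊛ 𝟘
      ≡⟨ trans (cong (b zero ⊕_) (⊛-zeroʳ (b (fromℕ (suc m))))) (⊕-identityʳ (b zero)) ⟩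
    b zero ∎

  module _ (p-prime : Prime p) where

    [n%p^k]C[1+j]≡nC[1+j] : ∀ {n j} → n ≤ p ^ k → suc j < p ^ k →
                            ((n % p ^ k) C suc j) mod p ≡ (n C suc j) mod p
    [n%p^k]C[1+j]≡nC[1+j] {n} {j} n≤N 1+j<N with m≤n⇒m<n∨m≡n n≤N
    ... | inj₁ n<N = cong (λ u → (u C suc j) mod p) (m<n⇒m%n≡m n<N)
    ... | inj₂ refl = begin
      ((p ^ k % p ^ k) C suc j) mod p  ≡⟨ cong (λ u → (u C suc j) mod p) (n%n≡0 (p ^ k)) ⟩
      𝟘                                ≡⟨ ∣⇒mod≡𝟘 (p∣p^kC[1+i] p-prime k 1+j<N) ⟨
      (p ^ k C suc j) mod p            ∎

    φ[1+j][x⊕𝟙]≡[1+x]C[1+j] : ∀ {j} → suc j < p ^ k → ∀ x → φ p k (suc j) (x ⊕ᴿ 𝟙ᴿ) ≡ (suc (toℕ x) C suc j) mod p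
    φ[1+j][x⊕𝟙]≡[1+x]C[1+j] {j} 1+j<N x = begin
      (toℕ (x ⊕ᴿ 𝟙ᴿ) C suc j) mod p                ≡⟨ cong (λ y → (toℕ y C suc j) mod p) (⊕𝟙ᴿ≡suc-mod x) ⟩
      (toℕ (suc (toℕ x) mod p ^ k) C suc j) mod p  ≡⟨ cong (λ u → (u C suc j) mod p) (toℕ-modᴿ (suc (toℕ x))) ⟩
      ((suc (toℕ x) % p ^ k) C suc j) mod p        ≡⟨ [n%p^k]C[1+j]≡nC[1+j] (toℕ<n x) 1+j<N ⟩
      (suc (toℕ x) C suc j) mod p                  ∎

    D-φ[1+j]≗φj : ∀ {j} → suc j < p ^ k → D p k (φ p k (suc j)) ≗ φ p k j
    D-φ[1+j]≗φj {j} 1+j<N x = begin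
      φ p k (suc j) (x ⊕ᴿ 𝟙ᴿ) ⊖ (t C suc j) mod p              ≡⟨ cong (_⊖ (t C suc j) mod p) (φ[1+j][x⊕𝟙]≡[1+x]C[1+j] 1+j<N x) ⟩
      (suc t C suc j) mod p ⊖ (t C suc j) mod p                ≡⟨ cong (λ u → u mod p ⊖ (t C suc j) mod p) (nCk+nC[k+1]≡[n+1]C[k+1] t j) ⟨
      (t C j + t C suc j) mod p ⊖ (t C suc j) mod p            ≡⟨ cong (_⊖ (t C suc j) mod p) (mod-distrib-+ (t C j) (t C suc j)) ⟩
      ((t C j) mod p ⊕ (t C suc j) mod p) ⊖ (t C suc j) mod p  ≡⟨ ⊕-⊖-cancelʳ _ _ ⟩
      (t C j) mod p                                            ∎
      where t = toℕ x

    D-linComb : ∀ m b → m < p ^ k → D p k (linComb p k (suc m) b) ≗ linComb p k m (λ i → b (suc i))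
    D-linComb zero    b _   x = trans (D-linear (const 𝟘) (φ p k 0) (b zero) x) (begin
      D p k (const 𝟘) x ⊕ b zero ⊛ D p k (φ p k 0) x  ≡⟨ cong₂ (λ u v → u ⊕ b zero ⊛ v) (⊖-self 𝟘) (D-φ₀≗𝟘 x) ⟩
      𝟘 ⊕ b zero ⊛ 𝟘                                  ≡⟨ trans (cong (𝟘 ⊕_) (⊛-zeroʳ (b zero))) (⊕-identityʳ 𝟘) ⟩
      𝟘                                               ∎)
    D-linComb (suc m) b m<N x = trans
      (D-linear (linComb p k (suc m) (λ i → b (inject₁ i))) (φ p k (suc m)) (b (fromℕ (suc m))) x)
      (cong₂ (λ u v → u ⊕ b (fromℕ (suc m)) ⊛ v)
             (D-linComb m (λ i → b (inject₁ i)) (≤-trans (n≤1+n (suc m)) m<N) x)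
             (D-φ[1+j]≗φj m<N x))

    Dpow-linComb≗𝟘 : ∀ m a → m ≤ p ^ k → Dpow p k m (linComb p k m a) ≗ const 𝟘
    Dpow-linComb≗𝟘 zero    a _   x = refl
    Dpow-linComb≗𝟘 (suc m) a m<N x = begin
      Dpow p k (suc m) (linComb p k (suc m) a) x      ≡⟨ Dpow-suc m _ x ⟩
      Dpow p k m (D p k (linComb p k (suc m) a)) x    ≡⟨ Dpow-cong m (D-linComb m a m<N) x ⟩
      Dpow p k m (linComb p k m (λ i → a (suc i))) x  ≡⟨ Dpow-linComb≗𝟘 m (λ i → a (suc i)) (<⇒≤ m<N) x ⟩
      𝟘                                               ∎

    InΩbelow⇒Dpow≗𝟘 : ∀ m (f : Fun) → m ≤ p ^ k → InΩbelow p k m f → Dpow p k m f ≗ const 𝟘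
    InΩbelow⇒Dpow≗𝟘 m f m≤N (a , f≗lc) x = trans (Dpow-cong m f≗lc x) (Dpow-linComb≗𝟘 m a m≤N x)

    Dpow≗𝟘⇒InΩbelow : ∀ m (f : Fun) → m ≤ p ^ k → Dpow p k m f ≗ const 𝟘 → InΩbelow p k m f
    Dpow≗𝟘⇒InΩbelow zero    f _   f≗𝟘    = (λ ()) , f≗𝟘
    Dpow≗𝟘⇒InΩbelow (suc m) f m<N Dᵐ⁺¹f≗𝟘
      with a , Df≗lc ← Dpow≗𝟘⇒InΩbelow m (D p k f) (<⇒≤ m<N) (λ x → trans (sym (Dpow-suc m f x)) (Dᵐ⁺¹f≗𝟘 x))
      = b , λ x → ⊖≡𝟘⇒≡ (trans (D≗𝟘⇒constant h Dh≗𝟘 x) h𝟘≡𝟘)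
      where
      -- the coefficients of D f, shifted up one place, with constant term f 0
      b = f 𝟘ᴿ ∷ a
      g = linComb p k (suc m) b
      h : Fun
      h y = f y ⊖ g y
      Dh≗𝟘 : D p k h ≗ const 𝟘
      Dh≗𝟘 x = begin
        D p k h x                              ≡⟨ D-distrib-⊖ f g x ⟩
        D p k f x ⊖ D p k g x                  ≡⟨ cong₂ _⊖_ (Df≗lc x) (D-linComb m b m<N x) ⟩
        linComb p k m a x ⊖ linComb p k m a x  ≡⟨ ⊖-self (linComb p k m a x) ⟩
        𝟘                                      ∎
      h𝟘≡𝟘 : h 𝟘ᴿ ≡ 𝟘
      h𝟘≡𝟘 = trans (cong (f 𝟘ᴿ ⊖_) (linComb-at-𝟘ᴿ m b)) (⊖-self (f 𝟘ᴿ))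

lemma4p4 : (p k : ℕ) → .{{_ : NonZero p}} → Prime p →
           (m : ℕ) → m < p ^ k → (f : R p k → Zp p) →
           (InΩbelow p k m f ⇔ IsZeroFun p k (Dpow p k m f))
           × (IsZeroFun p k (Dpow p k m f) ⇔
              ((c : Fin m → R p k) → IsZeroFun p k (iterΔ p k m c f)))
lemma4p4 p k p-prime m m<p^k f =
  mk⇔ (InΩbelow⇒Dpow≗𝟘 p-prime m f m≤p^k) (Dpow≗𝟘⇒InΩbelow p-prime m f m≤p^k) ,
  mk⇔ (Dpow≗𝟘⇒iterΔ≗𝟘 m f) (iterΔ≗𝟘⇒Dpow≗𝟘 m f)
  where
  open Differences p k
  m≤p^k = <⇒≤ m<p^k
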